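{- If $n$ is an odd positive integer with $m$ distinct prime factors, then \[ \omega(\mathcal{U}(\mathbb{Z}_n)) = \chi(\mathcal{U}(\mathbb{Z}_n)) = m + \frac{\phi(n)}{2^m}. \]
   Context: For a finite ring $R$ with unity and unit group $R^*$, the unitary addition Cayley graph $\mathcal{U}(R)$ is the simple graph with vertex set $R$ in which distinct vertices $x,y$ are adjacent if and only if $x+y \in R^*$. $\mathbb{Z}_n$ is the ring of integers modulo $n$, $\phi$ is Euler's totient function, and $\omega(G)$, $\chi(G)$ denote the clique number and chromatic number of a graph $G$. -}

module Defs where

open import Data.Nat using (ℕ; zero; suc; _+_; _*_; _%_; _≤_; NonZero)
open import Data.Nat.Divisibility using (_∣?_)
open import Data.Nat.Primality using (prime?)
open import Data.Nat.Coprimality using (coprime?)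
open import Data.Fin using (Fin; toℕ)
open import Data.List using (List; length; filter; upTo)
open import Data.Product using (Σ; ∃; _×_)
open import Function.Definitions using (Injective)
open import Relation.Binary.PropositionalEquality using (_≡_; _≢_)
open import Relation.Nullary.Decidable using (_×-dec_)

IsUnit : (n : ℕ) → .{{NonZero n}} → ℕ → Set
IsUnit n x = ∃ λ y → (x * y) % n ≡ 1 % n

-- Adjacency in the unitary addition Cayley graph U(ℤ_n), vertex set Fin n ≅ ℤ_n.
Adj : (n : ℕ) → .{{NonZero n}} → Fin n → Fin n → Set
Adj n x y = x ≢ y × IsUnit n (toℕ x + toℕ y)

Clique : (n : ℕ) → .{{NonZero n}} → ℕ → Set
Clique n k = Σ (Fin k → Fin n) λ f →
  Injective _≡_ _≡_ f × (∀ i j → i ≢ j → Adj n (f i) (f j))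

CliqueNumber : (n : ℕ) → .{{NonZero n}} → ℕ → Set
CliqueNumber n k = Clique n k × (∀ j → Clique n j → j ≤ k)

Colouring : (n : ℕ) → .{{NonZero n}} → ℕ → Set
Colouring n k = Σ (Fin n → Fin k) λ c → ∀ x y → Adj n x y → c x ≢ c y

ChromaticNumber : (n : ℕ) → .{{NonZero n}} → ℕ → Set
ChromaticNumber n k = Colouring n k × (∀ j → Colouring n j → k ≤ j)

-- Euler's totient: #{ 0 ≤ k < n : gcd(k,n) = 1 }  (so φ 1 = 1).
φ : ℕ → ℕ
φ n = length (filter (λ k → coprime? k n) (upTo n))

numPrimeFactors : ℕ → ℕ
numPrimeFactors n = length (filter (λ p → prime? p ×-dec (p ∣? n)) (upTo (suc n)))

{-# OPTIONS --safe #-}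
-- Let p₁, …, pₘ be the (odd) prime divisors of n, and call a unit x of ℤₙ lower when every
-- residue x mod pᵢ lies in (0, pᵢ/2). Multiplication by an element σᵢ with σᵢ ≡ -1 (mod pᵢ) and
-- σᵢ ≡ 1 (mod pⱼ), j ≠ i, is injective on ℤₙ and exchanges the units that are lower at pᵢ with
-- those that are not, so imposing lowerness one prime at a time halves the count each time:
-- there are φ(n)/2ᵐ lower units.
--
-- Clique: the lower units together with elements eᵢ ≡ 0 (mod pᵢ), eᵢ ≡ 1 (mod pⱼ), j ≠ i.
-- Modulo each pᵢ all their residues lie in [0, pᵢ/2) and at most one of them is 0, so every
-- pairwise sum is a unit.
--
-- Colouring: a non-unit gets the colour of some pᵢ dividing it; a unit gets the lower unit
-- reached by multiplying by σᵢ at each prime where it is not yet lower. Two distinct units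
-- reaching the same lower unit are negatives of each other modulo some pᵢ, so they are not
-- adjacent.
module Submission where

open import Defs

open import Level using (Level)
open import Data.Nat
  using ( ℕ; zero; suc; _+_; _*_; _^_; _/_; _≤_; _<_; _<?_; _≟_; s≤s; z<s; s<s
        ; NonZero; ≢-nonZero; ≢-nonZero⁻¹; nonTrivial⇒n>1; nonTrivial⇒≢1)
open import Data.Nat.Properties
open import Data.Nat.DivMod hiding (_mod_)
open import Data.Nat.Divisibility
open import Data.Nat.Coprimality using (Coprime; coprime?; coprime-Bézout)
open import Data.Nat.GCD using (module Bézout)
open import Data.Nat.Primality using (Prime; prime?; prime⇒irreducible; prime⇒nonZero; prime⇒nonTrivial)
open import Data.Nat.Primality.Factorisation using (factorise; factorisationHasAllPrimeFactors)
open import Data.Nat.ListAction using (product)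
open import Data.Nat.ListAction.Properties using (∈⇒∣product)
open import Data.Nat.Tactic.RingSolver using (solve-∀)
open import Data.Fin using (Fin; zero; suc; toℕ; fromℕ<; join; splitAt) renaming (_≟_ to _≟ᶠ_)
open import Data.Fin.Properties using (injective⇒≤; toℕ-fromℕ<; toℕ<n; toℕ-injective; splitAt-join)
open import Data.List using (List; []; _∷_; _++_; length; filter; lookup; upTo; tabulate)
open import Data.List.Properties using (length-++; length-tabulate)
open import Data.List.Relation.Unary.All as All using (All; []; _∷_)
open import Data.List.Relation.Unary.Any as Any using (Any; here; there)
open import Data.List.Relation.Unary.Any.Properties using (lookup-index)
open import Data.List.Relation.Unary.AllPairs using ([]; _∷_)
open import Data.List.Relation.Unary.Unique.Propositional using (Unique)
open import Data.List.Relation.Binary.Disjoint.Propositional using (Disjoint)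
import Data.List.Relation.Unary.Unique.Propositional.Properties as Unique
open import Data.List.Membership.Propositional using (_∈_)
open import Data.List.Membership.Propositional.Properties
  using (∈-lookup; ∈-filter⁺; ∈-filter⁻; ∈-upTo⁺; ∈-upTo⁻; ∈-tabulate⁻; ∈-++⁻)
open import Data.List.Membership.Setoid.Properties using (index-injective)
open import Data.List.Relation.Unary.All.Properties using (¬All⇒Any¬)
open import Data.Product using (∃; _×_; _,_; proj₁; proj₂)
open import Data.Sum as Sum using (_⊎_; inj₁; inj₂)
open import Data.Sum.Properties using (inj₁-injective; inj₂-injective)
open import Data.Empty using (⊥; ⊥-elim)
open import Relation.Nullary using (¬_; yes; no; ¬?; contradiction)
open import Relation.Nullary.Decidable using (_×-dec_; decidable-stable)
open import Relation.Unary using (Pred; Decidable)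
open import Relation.Unary.Properties using (∁?)
open import Relation.Binary.PropositionalEquality
open import Function using (_∘_; id)
open import Function.Definitions using (Injective)

private variable
  a b p : Level
  A : Set a
  B : Set b

-- Counting in duplicate-free lists

Unique⇒lookup-injective : ∀ {xs : List A} → Unique xs →
                          ∀ i j → lookup xs i ≡ lookup xs j → i ≡ j
Unique⇒lookup-injective (_ ∷ _)     zero    zero    _  = refl
Unique⇒lookup-injective (x∉ ∷ _)   zero    (suc j) eq = ⊥-elim (All.lookup x∉ (∈-lookup j) eq)
Unique⇒lookup-injective (x∉ ∷ _)   (suc i) zero    eq = ⊥-elim (All.lookup x∉ (∈-lookup i) (sym eq))
Unique⇒lookup-injective (_ ∷ xs!)  (suc i) (suc j) eq = cong suc (Unique⇒lookup-injective xs! i j eq)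

InjectiveOn : (A → B) → List A → Set _
InjectiveOn f xs = ∀ {x y} → x ∈ xs → y ∈ xs → f x ≡ f y → x ≡ y

Unique⇒length≤ : ∀ {xs : List A} {ys : List B} (f : A → B) → Unique xs →
                 (∀ {x} → x ∈ xs → f x ∈ ys) → InjectiveOn f xs → length xs ≤ length ys
Unique⇒length≤ {xs = xs} f xs! f∈ f-inj = injective⇒≤ {f = position} position-injective
  where
  position : Fin (length xs) → Fin _
  position i = Any.index (f∈ (∈-lookup i))
  position-injective : ∀ {i j} → position i ≡ position j → i ≡ j
  position-injective {i} {j} eq = Unique⇒lookup-injective xs! i j
    (f-inj (∈-lookup i) (∈-lookup j) (index-injective (setoid _) (f∈ (∈-lookup i)) (f∈ (∈-lookup j)) eq))

module _ {P : Pred A p} (P? : Decidable P) where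

  length≡length-filter+length-filter-∁ : ∀ xs →
    length xs ≡ length (filter P? xs) + length (filter (∁? P?) xs)
  length≡length-filter+length-filter-∁ []       = refl
  length≡length-filter+length-filter-∁ (x ∷ xs) with P? x
  ... | yes _ = cong suc (length≡length-filter+length-filter-∁ xs)
  ... | no  _ = trans (cong suc (length≡length-filter+length-filter-∁ xs)) (sym (+-suc _ _))

  length≡2*length-filter : ∀ {xs} (f : A → A) → Unique xs →
    (∀ {x} → x ∈ xs → f x ∈ xs) → InjectiveOn f xs →
    (∀ {x} → x ∈ xs → P x → ¬ P (f x)) → (∀ {x} → x ∈ xs → ¬ P x → P (f x)) →
    length xs ≡ 2 * length (filter P? xs)
  length≡2*length-filter {xs} f xs! f∈ f-inj P⇒¬Pf ¬P⇒Pf = begin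
    length xs       ≡⟨ length≡length-filter+length-filter-∁ xs ⟩
    yes# + no#      ≡⟨ cong (yes# +_) (≤-antisym yes#≤no# no#≤yes#) ⟨
    yes# + yes#     ≡⟨ cong (yes# +_) (+-identityʳ yes#) ⟨
    2 * yes#        ∎
    where
    open ≡-Reasoning
    yes# = length (filter P? xs)
    no#  = length (filter (∁? P?) xs)
    restrict : ∀ {Q : Pred A p} (Q? : Decidable Q) {x} → x ∈ filter Q? xs → x ∈ xs
    restrict Q? x∈ = proj₁ (∈-filter⁻ Q? x∈)
    yes#≤no# : yes# ≤ no#
    yes#≤no# = Unique⇒length≤ f (Unique.filter⁺ P? xs!)
      (λ x∈ → let x∈xs , Px = ∈-filter⁻ P? x∈
              in ∈-filter⁺ (∁? P?) (f∈ x∈xs) (P⇒¬Pf x∈xs Px))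
      (λ x∈ y∈ → f-inj (restrict P? x∈) (restrict P? y∈))
    no#≤yes# : no# ≤ yes#
    no#≤yes# = Unique⇒length≤ f (Unique.filter⁺ (∁? P?) xs!)
      (λ x∈ → let x∈xs , ¬Px = ∈-filter⁻ (∁? P?) x∈
              in ∈-filter⁺ P? (f∈ x∈xs) (¬P⇒Pf x∈xs ¬Px))
      (λ x∈ y∈ → f-inj (restrict (∁? P?) x∈) (restrict (∁? P?) y∈))

-- Congruences and lower halves

-- Defined by cases on the modulus, so that it can be stated for a variable modulus
-- without a NonZero instance.
infix 4 _≡_mod_
_≡_mod_ : ℕ → ℕ → ℕ → Set
x ≡ y mod zero      = x ≡ y
x ≡ y mod d@(suc _) = x % d ≡ y % d

≡-mod-refl : ∀ {d x} → x ≡ x mod d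
≡-mod-refl {d = zero}  = refl
≡-mod-refl {d = suc _} = refl

≡-mod-sym : ∀ {d x y} → x ≡ y mod d → y ≡ x mod d
≡-mod-sym {d = zero}  = sym
≡-mod-sym {d = suc _} = sym

≡-mod-trans : ∀ {d x y z} → x ≡ y mod d → y ≡ z mod d → x ≡ z mod d
≡-mod-trans {d = zero}  = trans
≡-mod-trans {d = suc _} = trans

+-cong-≡-mod : ∀ {d w x y z} → w ≡ x mod d → y ≡ z mod d → w + y ≡ x + z mod d
+-cong-≡-mod {d = zero}                    = cong₂ _+_
+-cong-≡-mod {d = d@(suc _)} {w} {x} {y} {z} w≡x y≡z = begin
  (w + y) % d             ≡⟨ %-distribˡ-+ w y d ⟩
  (w % d + y % d) % d     ≡⟨ cong₂ (λ a b → (a + b) % d) w≡x y≡z ⟩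
  (x % d + z % d) % d     ≡⟨ %-distribˡ-+ x z d ⟨
  (x + z) % d             ∎
  where open ≡-Reasoning

%-≡-mod : ∀ {d n} .{{_ : NonZero n}} → d ∣ n → ∀ x → x % n ≡ x mod d
%-≡-mod {zero}  {n} 0∣n = contradiction (0∣⇒≡0 0∣n) (≢-nonZero⁻¹ n)
%-≡-mod {suc _} {n} d∣n x = m∣n⇒o%n%m≡o%m _ n x d∣n

+-∣-≡-mod : ∀ {d w} → d ∣ w → ∀ x → x + w ≡ x mod d
+-∣-≡-mod {d = zero}  0∣w x rewrite 0∣⇒≡0 0∣w = +-identityʳ x
+-∣-≡-mod {d = suc _} d∣w x = %-remove-+ʳ x d∣w

∣-resp-≡-mod : ∀ {d x y} → x ≡ y mod d → d ∣ x → d ∣ y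
∣-resp-≡-mod {d = zero}                  x≡y = subst (0 ∣_) x≡y
∣-resp-≡-mod {d@(suc _)} {x} {y} x≡y d∣x =
  m%n≡0⇒n∣m y d (trans (sym x≡y) (n∣m⇒m%n≡0 x d d∣x))

Low : ℕ → ℕ → Set
Low zero        _ = ⊥
Low d@(suc _) x = 2 * (x % d) < d

LowerHalf : ℕ → ℕ → Set
LowerHalf d x = ¬ d ∣ x × Low d x

Low? : ∀ d → Decidable (Low d)
Low? zero        _ = no λ ()
Low? d@(suc _) x = 2 * (x % d) <? d

LowerHalf? : ∀ d → Decidable (LowerHalf d)
LowerHalf? d x = ¬? (d ∣? x) ×-dec Low? d x

Low-resp-≡-mod : ∀ {d x y} → x ≡ y mod d → Low d x → Low d y
Low-resp-≡-mod {d@(suc _)} x≡y = subst (λ r → 2 * r < d) x≡y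

LowerHalf-resp-≡-mod : ∀ {d x y} → x ≡ y mod d → LowerHalf d x → LowerHalf d y
LowerHalf-resp-≡-mod x≡y (d∤x , low) =
  d∤x ∘ ∣-resp-≡-mod (≡-mod-sym x≡y) , Low-resp-≡-mod x≡y low

∣⇒Low : ∀ {d x} .{{_ : NonZero d}} → d ∣ x → Low d x
∣⇒Low {d@(suc _)} {x} d∣x rewrite n∣m⇒m%n≡0 x d d∣x = z<s

≡1⇒Low : ∀ {d x} → 2 < d → x ≡ 1 mod d → Low d x
≡1⇒Low {d@(suc _)} 2<d x≡1 rewrite x≡1 | m<n⇒m%n≡m (<-trans (s<s z<s) 2<d) = 2<d

d∣r∧0<r<2d⇒r≡d : ∀ {d r} → d ∣ r → 0 < r → r < d + d → r ≡ d
d∣r∧0<r<2d⇒r≡d {d} (divides-refl 1)             _ _    = *-identityˡ d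
d∣r∧0<r<2d⇒r≡d {d} (divides-refl (suc (suc q))) _ r<2d =
  contradiction r<2d (≤⇒≯ (+-monoʳ-≤ d (m≤m+n d (q * d))))

∤x∧∣x+y⇒x%d+y%d≡d : ∀ {d x y} .{{_ : NonZero d}} → ¬ d ∣ x → d ∣ x + y → x % d + y % d ≡ d
∤x∧∣x+y⇒x%d+y%d≡d {d} {x} {y} d∤x d∣x+y =
  d∣r∧0<r<2d⇒r≡d d∣r 0<r (+-mono-< (m%n<n x d) (m%n<n y d))
  where
  d∣r : d ∣ x % d + y % d
  d∣r = m%n≡0⇒n∣m _ d (trans (sym (%-distribˡ-+ x y d)) (n∣m⇒m%n≡0 _ d d∣x+y))
  0<r : 0 < x % d + y % d
  0<r = <-≤-trans (n≢0⇒n>0 (d∤x ∘ m%n≡0⇒n∣m x d)) (m≤m+n _ _)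

2*[x%d]+2*[y%d]≡d+d : ∀ {d x y} .{{_ : NonZero d}} → ¬ d ∣ x → d ∣ x + y →
                      2 * (x % d) + 2 * (y % d) ≡ d + d
2*[x%d]+2*[y%d]≡d+d {d} {x} {y} d∤x d∣x+y = begin
  2 * (x % d) + 2 * (y % d)  ≡⟨ *-distribˡ-+ 2 (x % d) (y % d) ⟨
  2 * (x % d + y % d)        ≡⟨ cong (2 *_) (∤x∧∣x+y⇒x%d+y%d≡d d∤x d∣x+y) ⟩
  2 * d                      ≡⟨ cong (d +_) (+-identityʳ d) ⟩
  d + d                      ∎
  where open ≡-Reasoning

LowerHalf-flip : ∀ {d x y} → d ∣ x + y → LowerHalf d x → ¬ LowerHalf d y
LowerHalf-flip {suc _} d∣x+y (d∤x , low-x) (_ , low-y) =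
  <-irrefl (2*[x%d]+2*[y%d]≡d+d d∤x d∣x+y) (+-mono-< low-x low-y)

-- For odd d no residue sits exactly at d/2, so one of x and -x is in the lower half.
¬LowerHalf-flip : ∀ {d x y} → ¬ 2 ∣ d → ¬ d ∣ x → d ∣ x + y → ¬ LowerHalf d x → LowerHalf d y
¬LowerHalf-flip {zero}                 d-odd = contradiction (2 ∣0) d-odd
¬LowerHalf-flip {d@(suc _)} {x} {y} d-odd d∤x d∣x+y ¬lower-x = d∤y , low-y
  where
  d∤y : ¬ d ∣ y
  d∤y d∣y = d∤x (∣m+n∣m⇒∣n (subst (d ∣_) (+-comm x y) d∣x+y) d∣y)
  d<2rx : d < 2 * (x % d)
  d<2rx = ≤∧≢⇒< (≮⇒≥ (¬lower-x ∘ (d∤x ,_))) λ d≡2rx →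
    d-odd (divides (x % d) (trans d≡2rx (*-comm 2 (x % d))))
  low-y : Low d y
  low-y = ≰⇒> λ d≤2ry → <-irrefl (sym (trans (+-comm (2 * (y % d)) _) (2*[x%d]+2*[y%d]≡d+d d∤x d∣x+y)))
                                 (+-mono-≤-< d≤2ry d<2rx)

Low-+ : ∀ {d x y} → Low d x → Low d y → ¬ d ∣ x → ¬ d ∣ x + y
Low-+ {d@(suc _)} {x} {y} low-x low-y d∤x d∣x+y = d∤x (m%n≡0⇒n∣m x d (m+n≡0⇒m≡0 (x % d) r≡0))
  where
  r<d : x % d + y % d < d
  r<d = *-cancelˡ-< 2 (x % d + y % d) d
          (subst₂ _<_ (sym (*-distribˡ-+ 2 (x % d) (y % d))) (cong (d +_) (sym (+-identityʳ d)))
                      (+-mono-< low-x low-y))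
  r≡0 : x % d + y % d ≡ 0
  r≡0 = trans (sym (m<n⇒m%n≡m r<d)) (trans (sym (%-distribˡ-+ x y d)) (n∣m⇒m%n≡0 _ d d∣x+y))

-- Coprimality and units

∃prime∣ : ∀ {d} .{{_ : NonZero d}} → d ≢ 1 → ∃ λ p → Prime p × p ∣ d
∃prime∣ {d} d≢1 with factorise d
... | record { factors = [] ; isFactorisation = d≡1 } = contradiction d≡1 d≢1
... | record { factors = p ∷ ps ; isFactorisation = d≡Π ; factorsPrime = p-prime ∷ _ } =
  p , p-prime , subst (p ∣_) (sym d≡Π) (m∣m*n (product ps))

prime∤⇒coprime : ∀ {p m} → Prime p → ¬ p ∣ m → Coprime p m
prime∤⇒coprime p-prime p∤m (d∣p , d∣m) with prime⇒irreducible p-prime d∣p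
... | inj₁ d≡1  = d≡1
... | inj₂ refl = contradiction d∣m p∤m

coprime⇒∃multiple≡-1 : ∀ {d m} .{{_ : NonZero d}} → Coprime d m → ∃ λ w → m ∣ w × d ∣ suc w
coprime⇒∃multiple≡-1 {suc k} {m} coprime with coprime-Bézout coprime
... | Bézout.+- a b 1+bm≡a[1+k] = b * m , n∣m*n b , divides a 1+bm≡a[1+k]
... | Bézout.-+ a b 1+a[1+k]≡bm = k * (b * m) , ∣n⇒∣m*n k (n∣m*n b) , divides (1 + k * a) (begin
  suc (k * (b * m))             ≡⟨ cong (λ t → suc (k * t)) 1+a[1+k]≡bm ⟨
  suc (k * (1 + a * suc k))     ≡⟨ identity k a ⟩
  (1 + k * a) * suc k           ∎)
  where
  open ≡-Reasoning
  identity : ∀ k a → suc (k * (1 + a * suc k)) ≡ (1 + k * a) * suc k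
  identity = solve-∀

coprime⇒isUnit : ∀ {n x} .{{_ : NonZero n}} → Coprime x n → IsUnit n x
coprime⇒isUnit {n@(suc k)} {x} coprime with coprime-Bézout coprime
... | Bézout.+- a b 1+bn≡ax = a , (begin
  (x * a) % n        ≡⟨ cong (_% n) (trans (*-comm x a) (sym 1+bn≡ax)) ⟩
  (1 + b * n) % n    ≡⟨ [m+kn]%n≡m%n 1 b n ⟩
  1 % n              ∎)
  where open ≡-Reasoning
... | Bézout.-+ a b 1+ax≡bn = a * k , (begin
  (x * (a * k)) % n              ≡⟨ [m+kn]%n≡m%n (x * (a * k)) 1 n ⟨
  (x * (a * k) + 1 * n) % n      ≡⟨ cong (_% n) (identity x a k) ⟩
  (1 + k * (1 + a * x)) % n      ≡⟨ cong (λ t → (1 + k * t) % n) 1+ax≡bn ⟩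
  (1 + k * (b * n)) % n          ≡⟨ cong (λ t → (1 + t) % n) (*-assoc k b n) ⟨
  (1 + k * b * n) % n            ≡⟨ [m+kn]%n≡m%n 1 (k * b) n ⟩
  1 % n                          ∎)
  where
  open ≡-Reasoning
  identity : ∀ x a k → x * (a * k) + 1 * suc k ≡ 1 + k * (1 + a * x)
  identity = solve-∀

isUnit⇒coprime : ∀ {n x} .{{_ : NonZero n}} → IsUnit n x → Coprime x n
isUnit⇒coprime {x = x} (y , xy≡1) (d∣x , d∣n) =
  ∣1⇒≡1 (∣n∣m%n⇒∣m d∣n (subst (_ ∣_) xy≡1 (%-presˡ-∣ (∣m⇒∣m*n y d∣x) d∣n)))

coprime-*-cancelˡ-% : ∀ {n c x y} .{{_ : NonZero n}} → Coprime c n →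
                      (c * x) % n ≡ (c * y) % n → x % n ≡ y % n
coprime-*-cancelˡ-% {n} {c} {x} {y} coprime cx≡cy with coprime⇒isUnit coprime
... | u , cu≡1 = begin
  x % n                          ≡⟨ u[cz]≡z x ⟨
  (u * (c * x)) % n              ≡⟨ %-distribˡ-* u (c * x) n ⟩
  (u % n * ((c * x) % n)) % n    ≡⟨ cong (λ t → (u % n * t) % n) cx≡cy ⟩
  (u % n * ((c * y) % n)) % n    ≡⟨ %-distribˡ-* u (c * y) n ⟨
  (u * (c * y)) % n              ≡⟨ u[cz]≡z y ⟩
  y % n                          ∎
  where
  open ≡-Reasoning
  u[cz]≡z : ∀ z → (u * (c * z)) % n ≡ z % n
  u[cz]≡z z = begin
    (u * (c * z)) % n            ≡⟨ cong (_% n) (trans (cong (_* z) (*-comm c u)) (*-assoc u c z)) ⟨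
    (c * u * z) % n              ≡⟨ %-distribˡ-* (c * u) z n ⟩
    ((c * u) % n * (z % n)) % n  ≡⟨ cong (λ t → (t * (z % n)) % n) cu≡1 ⟩
    (1 % n * (z % n)) % n        ≡⟨ %-distribˡ-* 1 z n ⟨
    (1 * z) % n                  ≡⟨ cong (_% n) (*-identityˡ z) ⟩
    z % n                        ∎

-- Cliques and colourings of U(ℤₙ)

module _ {n : ℕ} .{{_ : NonZero n}} where

  clique-fromList : ∀ {xs : List ℕ} → Unique xs → (∀ {x} → x ∈ xs → x < n) →
                    (∀ {x y} → x ∈ xs → y ∈ xs → x ≢ y → IsUnit n (x + y)) →
                    Clique n (length xs)
  clique-fromList {xs} xs! xs<n adjacent = vertex , vertex-injective , vertex-adjacent
    where
    vertex : Fin (length xs) → Fin n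
    vertex i = fromℕ< (xs<n (∈-lookup i))
    toℕ-vertex : ∀ i → toℕ (vertex i) ≡ lookup xs i
    toℕ-vertex i = toℕ-fromℕ< (xs<n (∈-lookup i))
    lookup-injective = Unique⇒lookup-injective xs!
    vertex-injective : Injective _≡_ _≡_ vertex
    vertex-injective {i} {j} eq =
      lookup-injective i j (trans (sym (toℕ-vertex i)) (trans (cong toℕ eq) (toℕ-vertex j)))
    vertex-adjacent : ∀ i j → i ≢ j → Adj n (vertex i) (vertex j)
    vertex-adjacent i j i≢j =
      i≢j ∘ vertex-injective ,
      subst (IsUnit n) (sym (cong₂ _+_ (toℕ-vertex i) (toℕ-vertex j)))
        (adjacent (∈-lookup i) (∈-lookup j) (i≢j ∘ lookup-injective i j))

  clique-size≤colours : ∀ {j k} → Clique n j → Colouring n k → j ≤ k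
  clique-size≤colours (f , _ , adjacent) (c , proper) = injective⇒≤ {f = c ∘ f} λ {i} {i′} ci≡ci′ →
    decidable-stable (i ≟ᶠ i′) λ i≢i′ → proper (f i) (f i′) (adjacent i i′ i≢i′) ci≡ci′

  clique∧colouring⇒cliqueNumber∧chromaticNumber : ∀ {k} → Clique n k → Colouring n k →
                                                  CliqueNumber n k × ChromaticNumber n k
  clique∧colouring⇒cliqueNumber∧chromaticNumber clique colouring =
    (clique , λ _ clique′ → clique-size≤colours clique′ colouring) ,
    (colouring , λ _ colouring′ → clique-size≤colours clique colouring′)

module UnitaryCayley (n : ℕ) .{{_ : NonZero n}} (n-odd : ¬ 2 ∣ n) where

  primeDivisor? : Decidable (λ p → Prime p × p ∣ n)
  primeDivisor? p = prime? p ×-dec p ∣? n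

  primes : List ℕ
  primes = filter primeDivisor? (upTo (suc n))

  m : ℕ
  m = length primes

  primes⊆primes : All (_∈ primes) primes
  primes⊆primes = All.tabulate id

  primes! : Unique primes
  primes! = Unique.filter⁺ primeDivisor? (Unique.upTo⁺ (suc n))

  ∈primes⁺ : ∀ {p} → Prime p → p ∣ n → p ∈ primes
  ∈primes⁺ p-prime p∣n = ∈-filter⁺ primeDivisor? (∈-upTo⁺ (s≤s (∣⇒≤ p∣n))) (p-prime , p∣n)

  module _ {p} (p∈ : p ∈ primes) where

    ∈primes⇒prime : Prime p
    ∈primes⇒prime = proj₁ (proj₂ (∈-filter⁻ primeDivisor? {xs = upTo (suc n)} p∈))

    ∈primes⇒∣n : p ∣ n
    ∈primes⇒∣n = proj₂ (proj₂ (∈-filter⁻ primeDivisor? {xs = upTo (suc n)} p∈))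

    ∈primes⇒nonZero : NonZero p
    ∈primes⇒nonZero = prime⇒nonZero ∈primes⇒prime

    ∈primes⇒∤1 : ¬ p ∣ 1
    ∈primes⇒∤1 p∣1 = nonTrivial⇒≢1 {{prime⇒nonTrivial ∈primes⇒prime}} (∣1⇒≡1 p∣1)

    ∈primes⇒odd : ¬ 2 ∣ p
    ∈primes⇒odd 2∣p = n-odd (∣-trans 2∣p ∈primes⇒∣n)

    ∈primes⇒2<p : 2 < p
    ∈primes⇒2<p = ≤∧≢⇒< (nonTrivial⇒n>1 p {{prime⇒nonTrivial ∈primes⇒prime}})
                        (∈primes⇒odd ∘ ∣-reflexive)

  coprime⇒∤ : ∀ {x p} → Coprime x n → p ∈ primes → ¬ p ∣ x
  coprime⇒∤ coprime p∈ p∣x = ∈primes⇒∤1 p∈ (∣-reflexive (coprime (p∣x , ∈primes⇒∣n p∈)))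

  ∤⇒coprime : ∀ {x} → (∀ {p} → p ∈ primes → ¬ p ∣ x) → Coprime x n
  ∤⇒coprime ∤x {d} (d∣x , d∣n) = decidable-stable (d ≟ 1) λ d≢1 →
    let p , p-prime , p∣d = ∃prime∣ {{d-nonZero}} d≢1
    in ∤x (∈primes⁺ p-prime (∣-trans p∣d d∣n)) (∣-trans p∣d d∣x)
    where
    d-nonZero : NonZero d
    d-nonZero = ≢-nonZero λ { refl → ≢-nonZero⁻¹ n (0∣⇒≡0 d∣n) }

  unit? : Decidable (λ x → Coprime x n)
  unit? x = coprime? x n

  units : List ℕ
  units = filter unit? (upTo n)

  ∈units⁺ : ∀ {x} → x < n → Coprime x n → x ∈ units
  ∈units⁺ x<n coprime = ∈-filter⁺ unit? (∈-upTo⁺ x<n) (λ {d} → coprime {d})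

  ∈units⇒< : ∀ {x} → x ∈ units → x < n
  ∈units⇒< x∈ = ∈-upTo⁻ (proj₁ (∈-filter⁻ unit? x∈))

  ∈units⇒coprime : ∀ {x} → x ∈ units → Coprime x n
  ∈units⇒coprime x∈ = proj₂ (∈-filter⁻ unit? {xs = upTo n} x∈)

  lowerUnits : List ℕ → List ℕ
  lowerUnits []      = units
  lowerUnits (q ∷ S) = filter (LowerHalf? q) (lowerUnits S)

  lowerUnits! : ∀ S → Unique (lowerUnits S)
  lowerUnits! []      = Unique.filter⁺ unit? (Unique.upTo⁺ n)
  lowerUnits! (q ∷ S) = Unique.filter⁺ (LowerHalf? q) (lowerUnits! S)

  ∈lowerUnits⇒∈units : ∀ S {x} → x ∈ lowerUnits S → x ∈ units
  ∈lowerUnits⇒∈units []      x∈ = x∈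
  ∈lowerUnits⇒∈units (q ∷ S) x∈ = ∈lowerUnits⇒∈units S (proj₁ (∈-filter⁻ (LowerHalf? q) x∈))

  ∈lowerUnits⇒lowerHalf : ∀ S {x} → x ∈ lowerUnits S → All (λ q → LowerHalf q x) S
  ∈lowerUnits⇒lowerHalf []      _  = []
  ∈lowerUnits⇒lowerHalf (q ∷ S) x∈ =
    let x∈S , lower = ∈-filter⁻ (LowerHalf? q) x∈ in lower ∷ ∈lowerUnits⇒lowerHalf S x∈S

  ∈lowerUnits⁺ : ∀ {S x} → x ∈ units → All (λ q → LowerHalf q x) S → x ∈ lowerUnits S
  ∈lowerUnits⁺ x∈ []                       = x∈
  ∈lowerUnits⁺ x∈ (_∷_ {q} lower lowers) = ∈-filter⁺ (LowerHalf? q) (∈lowerUnits⁺ x∈ lowers) lower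

  ∈lowerUnits-resp-≡-mod : ∀ {S x y} → x ∈ lowerUnits S → y ∈ units →
                           (∀ {r} → r ∈ S → x ≡ y mod r) → y ∈ lowerUnits S
  ∈lowerUnits-resp-≡-mod {S} x∈ y∈ x≡y = ∈lowerUnits⁺ y∈ (All.tabulate λ r∈ →
    LowerHalf-resp-≡-mod (x≡y r∈) (All.lookup (∈lowerUnits⇒lowerHalf S x∈) r∈))

  module AtPrime {q} (q∈ : q ∈ primes) where

    private instance
      q-nonZero : NonZero q
      q-nonZero = ∈primes⇒nonZero q∈

    private
      other? : Decidable (_≢ q)
      other? r = ¬? (r ≟ q)

      others : List ℕ
      others = filter other? primes

      q∤∏others : ¬ q ∣ product others
      q∤∏others q∣∏ = proj₂ (∈-filter⁻ other? {xs = primes} q∈others) refl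
        where
        q∈others = factorisationHasAllPrimeFactors (∈primes⇒prime q∈) q∣∏
          (All.tabulate λ r∈ → ∈primes⇒prime (proj₁ (∈-filter⁻ other? {xs = primes} r∈)))

      separator : ∃ λ w → product others ∣ w × q ∣ suc w
      separator = coprime⇒∃multiple≡-1 (prime∤⇒coprime (∈primes⇒prime q∈) q∤∏others)

    w : ℕ
    w = proj₁ separator

    q∣1+w : q ∣ suc w
    q∣1+w = proj₂ (proj₂ separator)

    other∣w : ∀ {r} → r ∈ primes → r ≢ q → r ∣ w
    other∣w r∈ r≢q = ∣-trans (∈⇒∣product (∈-filter⁺ other? r∈ r≢q)) (proj₁ (proj₂ separator))

    -- Multiplication by 1 + 2w, which is -1 modulo q and 1 modulo the other prime divisors of n.
    σ : ℕ → ℕ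
    σ x = ((1 + 2 * w) * x) % n

    σ<n : ∀ x → σ x < n
    σ<n x = m%n<n _ n

    σ-≡-mod : ∀ {r} → r ∈ primes → r ≢ q → ∀ x → σ x ≡ x mod r
    σ-≡-mod r∈ r≢q x = ≡-mod-trans (%-≡-mod (∈primes⇒∣n r∈) _)
                                   (+-∣-≡-mod (∣m⇒∣m*n x (∣n⇒∣m*n 2 (other∣w r∈ r≢q))) x)

    q∣x+σx : ∀ x → q ∣ x + σ x
    q∣x+σx x =
      ∣-resp-≡-mod (+-cong-≡-mod (≡-mod-refl {x = x}) (≡-mod-sym (%-≡-mod (∈primes⇒∣n q∈) _)))
                   (subst (q ∣_) (identity x w) (∣n⇒∣m*n (2 * x) q∣1+w))
      where
      identity : ∀ x w → 2 * x * suc w ≡ x + (1 + 2 * w) * x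
      identity = solve-∀

    σ-coprime : ∀ {x} → Coprime x n → Coprime (σ x) n
    σ-coprime {x} coprime = ∤⇒coprime r∤σx
      where
      r∤σx : ∀ {r} → r ∈ primes → ¬ r ∣ σ x
      r∤σx {r} r∈ r∣σx with r ≟ q
      ... | yes refl =
        coprime⇒∤ coprime r∈ (∣m+n∣m⇒∣n (subst (r ∣_) (+-comm x (σ x)) (q∣x+σx x)) r∣σx)
      ... | no  r≢q  = coprime⇒∤ coprime r∈ (∣-resp-≡-mod (σ-≡-mod r∈ r≢q x) r∣σx)

    σ-injective : ∀ {x y} → x < n → y < n → σ x ≡ σ y → x ≡ y
    σ-injective x<n y<n σx≡σy =
      trans (sym (m<n⇒m%n≡m x<n)) (trans (coprime-*-cancelˡ-% 1+2w-coprime σx≡σy) (m<n⇒m%n≡m y<n))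
      where
      1+2w-coprime : Coprime (1 + 2 * w) n
      1+2w-coprime (d∣1+2w , d∣n) =
        σ-coprime (λ (d∣1 , _) → ∣1⇒≡1 d∣1) (%-presˡ-∣ (∣m⇒∣m*n 1 d∣1+2w) d∣n , d∣n)

    toLowerHalf : ℕ → ℕ
    toLowerHalf x with LowerHalf? q x
    ... | yes _ = x
    ... | no  _ = σ x

    module _ {S} (S⊆ : All (_∈ primes) S) (q∉S : All (q ≢_) S) where

      σ-∈lowerUnits : ∀ {x} → x ∈ lowerUnits S → σ x ∈ lowerUnits S
      σ-∈lowerUnits {x} x∈ = ∈lowerUnits-resp-≡-mod x∈
        (∈units⁺ (σ<n x) (σ-coprime (∈units⇒coprime (∈lowerUnits⇒∈units S x∈))))
        (λ r∈ → ≡-mod-sym (σ-≡-mod (All.lookup S⊆ r∈) (≢-sym (All.lookup q∉S r∈)) x))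

      toLowerHalf-∈lowerUnits : ∀ {x} → x ∈ lowerUnits S → toLowerHalf x ∈ lowerUnits S
      toLowerHalf-∈lowerUnits {x} x∈ with LowerHalf? q x
      ... | yes _ = x∈
      ... | no  _ = σ-∈lowerUnits x∈

    toLowerHalf-lowerHalf : ∀ {x} → Coprime x n → LowerHalf q (toLowerHalf x)
    toLowerHalf-lowerHalf {x} coprime with LowerHalf? q x
    ... | yes lower  = lower
    ... | no  ¬lower = ¬LowerHalf-flip (∈primes⇒odd q∈) (coprime⇒∤ coprime q∈) (q∣x+σx x) ¬lower

    toLowerHalf-≡-mod : ∀ {r} → r ∈ primes → r ≢ q → ∀ x → toLowerHalf x ≡ x mod r
    toLowerHalf-≡-mod r∈ r≢q x with LowerHalf? q x
    ... | yes _ = ≡-mod-refl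
    ... | no  _ = σ-≡-mod r∈ r≢q x

    toLowerHalf-injective : ∀ {x y} → x < n → y < n → ¬ q ∣ x + y →
                            toLowerHalf x ≡ toLowerHalf y → x ≡ y
    toLowerHalf-injective {x} {y} x<n y<n q∤x+y with LowerHalf? q x | LowerHalf? q y
    ... | yes _ | yes _ = id
    ... | no  _ | no  _ = σ-injective x<n y<n
    ... | yes _ | no  _ = λ x≡σy →
      ⊥-elim (q∤x+y (subst (q ∣_) (+-comm y x) (subst (λ t → q ∣ y + t) (sym x≡σy) (q∣x+σx y))))
    ... | no  _ | yes _ = λ σx≡y → ⊥-elim (q∤x+y (subst (λ t → q ∣ x + t) σx≡y (q∣x+σx x)))

    e : ℕ
    e = suc w % n

    e<n : e < n
    e<n = m%n<n _ n

    q∣e : q ∣ e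
    q∣e = %-presˡ-∣ q∣1+w (∈primes⇒∣n q∈)

    e≡1 : ∀ {r} → r ∈ primes → r ≢ q → e ≡ 1 mod r
    e≡1 r∈ r≢q = ≡-mod-trans (%-≡-mod (∈primes⇒∣n r∈) (suc w)) (+-∣-≡-mod (other∣w r∈ r≢q) 1)

  length-lowerUnits-halves : ∀ {q S} → q ∈ primes → All (_∈ primes) S → All (q ≢_) S →
                             length (lowerUnits S) ≡ 2 * length (lowerUnits (q ∷ S))
  length-lowerUnits-halves {q} {S} q∈ S⊆ q∉S =
    length≡2*length-filter (LowerHalf? q) σ (lowerUnits! S) (σ-∈lowerUnits S⊆ q∉S)
      (λ x∈ y∈ → σ-injective (<n x∈) (<n y∈))
      (λ _ → LowerHalf-flip (q∣x+σx _))
      (λ x∈ → ¬LowerHalf-flip (∈primes⇒odd q∈) (coprime⇒∤ (coprime x∈) q∈) (q∣x+σx _))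
    where
    open AtPrime q∈
    <n : ∀ {x} → x ∈ lowerUnits S → x < n
    <n = ∈units⇒< ∘ ∈lowerUnits⇒∈units S
    coprime : ∀ {x} → x ∈ lowerUnits S → Coprime x n
    coprime = ∈units⇒coprime ∘ ∈lowerUnits⇒∈units S

  length-units : ∀ {S} → All (_∈ primes) S → Unique S →
                 length units ≡ 2 ^ length S * length (lowerUnits S)
  length-units []                   []           = sym (+-identityʳ _)
  length-units {q ∷ S} (q∈ ∷ S⊆) (q∉S ∷ S!) = begin
    length units             ≡⟨ length-units S⊆ S! ⟩
    2 ^ length S * ℓ         ≡⟨ cong (2 ^ length S *_) (length-lowerUnits-halves q∈ S⊆ q∉S) ⟩
    2 ^ length S * (2 * ℓ′)  ≡⟨ *-assoc (2 ^ length S) 2 ℓ′ ⟨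
    2 ^ length S * 2 * ℓ′    ≡⟨ cong (_* ℓ′) (*-comm (2 ^ length S) 2) ⟩
    2 * 2 ^ length S * ℓ′    ∎
    where
    open ≡-Reasoning
    ℓ  = length (lowerUnits S)
    ℓ′ = length (lowerUnits (q ∷ S))

  φ/2^m≡length-lowerUnits : (φ n / 2 ^ m) {{m^n≢0 2 m}} ≡ length (lowerUnits primes)
  φ/2^m≡length-lowerUnits = begin
    (φ n / 2 ^ m) {{m^n≢0 2 m}}        ≡⟨ cong /2^m (length-units primes⊆primes primes!) ⟩
    (2 ^ m * ℓ / 2 ^ m) {{m^n≢0 2 m}}  ≡⟨ cong /2^m (*-comm (2 ^ m) ℓ) ⟩
    (ℓ * 2 ^ m / 2 ^ m) {{m^n≢0 2 m}}  ≡⟨ m*n/n≡m ℓ (2 ^ m) {{m^n≢0 2 m}} ⟩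
    ℓ                                  ∎
    where
    open ≡-Reasoning
    /2^m : ℕ → ℕ
    /2^m t = (t / 2 ^ m) {{m^n≢0 2 m}}
    ℓ = length (lowerUnits primes)

  eVertex : Fin m → ℕ
  eVertex i = AtPrime.e (∈-lookup {xs = primes} i)

  lookup∣eVertex : ∀ i → lookup primes i ∣ eVertex i
  lookup∣eVertex i = AtPrime.q∣e (∈-lookup i)

  ∣eVertex⇒≡lookup : ∀ {p} i → p ∈ primes → p ∣ eVertex i → p ≡ lookup primes i
  ∣eVertex⇒≡lookup {p} i p∈ p∣e = decidable-stable (p ≟ lookup primes i) λ p≢ →
    ∈primes⇒∤1 p∈ (∣-resp-≡-mod (AtPrime.e≡1 (∈-lookup i) p∈ p≢) p∣e)

  eVertex-low : ∀ {p} i → p ∈ primes → Low p (eVertex i)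
  eVertex-low {p} i p∈ with p ≟ lookup primes i
  ... | yes refl = ∣⇒Low {{∈primes⇒nonZero p∈}} (lookup∣eVertex i)
  ... | no  p≢   = ≡1⇒Low (∈primes⇒2<p p∈) (AtPrime.e≡1 (∈-lookup i) p∈ p≢)

  cliqueList : List ℕ
  cliqueList = tabulate eVertex ++ lowerUnits primes

  length-cliqueList : length cliqueList ≡ m + length (lowerUnits primes)
  length-cliqueList =
    trans (length-++ (tabulate eVertex)) (cong (_+ length (lowerUnits primes)) (length-tabulate eVertex))

  ∈cliqueList⁻ : ∀ {x} → x ∈ cliqueList → (∃ λ i → x ≡ eVertex i) ⊎ x ∈ lowerUnits primes
  ∈cliqueList⁻ x∈ = Sum.map₁ ∈-tabulate⁻ (∈-++⁻ (tabulate eVertex) x∈)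

  ∈lowerUnits⇒∤ : ∀ {x p} → x ∈ lowerUnits primes → p ∈ primes → ¬ p ∣ x
  ∈lowerUnits⇒∤ x∈ = coprime⇒∤ (∈units⇒coprime (∈lowerUnits⇒∈units primes x∈))

  cliqueList! : Unique cliqueList
  cliqueList! = Unique.++⁺ (Unique.tabulate⁺ eVertex-injective) (lowerUnits! primes) disjoint
    where
    eVertex-injective : ∀ {i j} → eVertex i ≡ eVertex j → i ≡ j
    eVertex-injective {i} {j} eᵢ≡eⱼ = Unique⇒lookup-injective primes! i j
      (∣eVertex⇒≡lookup j (∈-lookup i) (subst (_ ∣_) eᵢ≡eⱼ (lookup∣eVertex i)))
    disjoint : Disjoint (tabulate eVertex) (lowerUnits primes)
    disjoint (x∈e , x∈lower) with ∈-tabulate⁻ x∈e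
    ... | i , refl = ∈lowerUnits⇒∤ x∈lower (∈-lookup i) (lookup∣eVertex i)

  cliqueList-< : ∀ {x} → x ∈ cliqueList → x < n
  cliqueList-< x∈ with ∈cliqueList⁻ x∈
  ... | inj₁ (i , refl) = AtPrime.e<n (∈-lookup i)
  ... | inj₂ x∈lower    = ∈units⇒< (∈lowerUnits⇒∈units primes x∈lower)

  cliqueList-low : ∀ {x p} → x ∈ cliqueList → p ∈ primes → Low p x
  cliqueList-low x∈ p∈ with ∈cliqueList⁻ x∈
  ... | inj₁ (i , refl) = eVertex-low i p∈
  ... | inj₂ x∈lower    = proj₂ (All.lookup (∈lowerUnits⇒lowerHalf primes x∈lower) p∈)

  -- A prime divisor of n divides only its own e-vertex.
  cliqueList-∣⇒≡ : ∀ {x y p} → x ∈ cliqueList → y ∈ cliqueList → p ∈ primes →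
                   p ∣ x → p ∣ y → x ≡ y
  cliqueList-∣⇒≡ x∈ y∈ p∈ p∣x p∣y with ∈cliqueList⁻ x∈ | ∈cliqueList⁻ y∈
  ... | inj₁ (i , refl) | inj₁ (j , refl) = cong eVertex (Unique⇒lookup-injective primes! i j
    (trans (sym (∣eVertex⇒≡lookup i p∈ p∣x)) (∣eVertex⇒≡lookup j p∈ p∣y)))
  ... | inj₂ x∈lower    | _               = contradiction p∣x (∈lowerUnits⇒∤ x∈lower p∈)
  ... | inj₁ _          | inj₂ y∈lower    = contradiction p∣y (∈lowerUnits⇒∤ y∈lower p∈)

  cliqueList-adjacent : ∀ {x y} → x ∈ cliqueList → y ∈ cliqueList → x ≢ y → IsUnit n (x + y)
  cliqueList-adjacent {x} {y} x∈ y∈ x≢y = coprime⇒isUnit (∤⇒coprime p∤x+y)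
    where
    p∤x+y : ∀ {p} → p ∈ primes → ¬ p ∣ x + y
    p∤x+y {p} p∈ with p ∣? x
    ... | no  p∤x = Low-+ (cliqueList-low x∈ p∈) (cliqueList-low y∈ p∈) p∤x
    ... | yes p∣x = Low-+ (cliqueList-low y∈ p∈) (cliqueList-low x∈ p∈) p∤y ∘ subst (p ∣_) (+-comm x y)
      where p∤y = x≢y ∘ cliqueList-∣⇒≡ x∈ y∈ p∈ p∣x

  clique : Clique n (m + length (lowerUnits primes))
  clique = subst (Clique n) length-cliqueList (clique-fromList cliqueList! cliqueList-< cliqueList-adjacent)

  normalise : ∀ {S} → All (_∈ primes) S → ℕ → ℕ
  normalise []          x = x
  normalise (q∈ ∷ S⊆) x = AtPrime.toLowerHalf q∈ (normalise S⊆ x)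

  normalise-≡-mod : ∀ {S r} (S⊆ : All (_∈ primes) S) → r ∈ primes → All (r ≢_) S →
                    ∀ x → normalise S⊆ x ≡ x mod r
  normalise-≡-mod []          _  _              _ = ≡-mod-refl
  normalise-≡-mod (q∈ ∷ S⊆) r∈ (r≢q ∷ r∉S) x =
    ≡-mod-trans (AtPrime.toLowerHalf-≡-mod q∈ r∈ r≢q _) (normalise-≡-mod S⊆ r∈ r∉S x)

  normalise-∈lowerUnits : ∀ {S x} (S⊆ : All (_∈ primes) S) → Unique S → x ∈ units →
                          normalise S⊆ x ∈ lowerUnits S
  normalise-∈lowerUnits []                            []           x∈ = x∈
  normalise-∈lowerUnits {q ∷ S} {x} (q∈ ∷ S⊆) (q∉S ∷ S!) x∈ =
    ∈-filter⁺ (LowerHalf? q) (toLowerHalf-∈lowerUnits S⊆ q∉S a∈)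
              (toLowerHalf-lowerHalf (∈units⇒coprime (∈lowerUnits⇒∈units S a∈)))
    where
    open AtPrime q∈
    a∈ = normalise-∈lowerUnits S⊆ S! x∈

  normalise-injective : ∀ {S x y} (S⊆ : All (_∈ primes) S) → Unique S → x ∈ units → y ∈ units →
                        (∀ {r} → r ∈ S → ¬ r ∣ x + y) → normalise S⊆ x ≡ normalise S⊆ y → x ≡ y
  normalise-injective []          []           _  _  _     = id
  normalise-injective {q ∷ S} {x} {y} (q∈ ∷ S⊆) (q∉S ∷ S!) x∈ y∈ r∤x+y =
    normalise-injective S⊆ S! x∈ y∈ (r∤x+y ∘ there) ∘ toLowerHalf-injective (<n x∈) (<n y∈) q∤a+b
    where
    open AtPrime q∈
    <n : ∀ {z} → z ∈ units → normalise S⊆ z < n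
    <n z∈ = ∈units⇒< (∈lowerUnits⇒∈units S (normalise-∈lowerUnits S⊆ S! z∈))
    q∤a+b : ¬ q ∣ normalise S⊆ x + normalise S⊆ y
    q∤a+b = r∤x+y (here refl) ∘ ∣-resp-≡-mod
      (+-cong-≡-mod (normalise-≡-mod S⊆ q∈ q∉S x) (normalise-≡-mod S⊆ q∈ q∉S y))

  ¬coprime⇒∃∣ : ∀ {x} → ¬ Coprime x n → Any (_∣ x) primes
  ¬coprime⇒∃∣ {x} ¬coprime = Any.map (decidable-stable (_ ∣? x))
    (¬All⇒Any¬ (λ p → ¬? (p ∣? x)) primes (¬coprime ∘ ∤⇒coprime ∘ All.lookup))

  colour : Fin n → Fin m ⊎ Fin (length (lowerUnits primes))
  colour x with unit? (toℕ x)
  ... | yes unit  =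
    inj₂ (Any.index (normalise-∈lowerUnits primes⊆primes primes! (∈units⁺ (toℕ<n x) unit)))
  ... | no  ¬unit = inj₁ (Any.index (¬coprime⇒∃∣ ¬unit))

  colour-proper : ∀ x y → Adj n x y → colour x ≢ colour y
  colour-proper x y (x≢y , x+y-unit) with unit? (toℕ x) | unit? (toℕ y)
  ... | yes x-unit | yes y-unit = λ cx≡cy → x≢y (toℕ-injective
    (normalise-injective primes⊆primes primes! (∈units⁺ (toℕ<n x) x-unit) (∈units⁺ (toℕ<n y) y-unit)
      (coprime⇒∤ (isUnit⇒coprime x+y-unit))
      (index-injective (setoid ℕ) _ _ (inj₂-injective cx≡cy))))
  ... | no ¬x-unit | no ¬y-unit = λ cx≡cy →
    let p∣x = subst (λ i → lookup primes i ∣ toℕ x) (inj₁-injective cx≡cy)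
                    (lookup-index (¬coprime⇒∃∣ ¬x-unit))
        p∣y = lookup-index (¬coprime⇒∃∣ ¬y-unit)
    in coprime⇒∤ (isUnit⇒coprime x+y-unit) (∈-lookup _) (∣m∣n⇒∣m+n p∣x p∣y)
  ... | yes _ | no  _ = λ ()
  ... | no  _ | yes _ = λ ()

  colouring : Colouring n (m + length (lowerUnits primes))
  colouring = join m _ ∘ colour , λ x y adjacent → colour-proper x y adjacent ∘ join-injective
    where
    join-injective : ∀ {c c′} → join m (length (lowerUnits primes)) c ≡ join m _ c′ → c ≡ c′
    join-injective {c} {c′} eq =
      trans (sym (splitAt-join m _ c)) (trans (cong (splitAt m) eq) (splitAt-join m _ c′))

corollary1 : (n : ℕ) → {{_ : NonZero n}} → ¬ (2 ∣ n) → (m : ℕ) → m ≡ numPrimeFactors n →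
    CliqueNumber n (m + (φ n / 2 ^ m) {{m^n≢0 2 m}})
      × ChromaticNumber n (m + (φ n / 2 ^ m) {{m^n≢0 2 m}})
corollary1 n n-odd _ refl =
  subst (λ k → CliqueNumber n k × ChromaticNumber n k) (cong (m +_) (sym φ/2^m≡length-lowerUnits))
    (clique∧colouring⇒cliqueNumber∧chromaticNumber clique colouring)
  where open UnitaryCayley n n-odd
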